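{- Let $\mathcal{S}$ be a finite commutative nilsemigroup. Then $\mathsf E(\mathcal{S})\leq \mathsf D(\mathcal{S})+\kappa(\mathcal{S})-1$.
   Context: A commutative nilsemigroup is a commutative semigroup (written additively) with a zero element $\infty_{\mathcal{S}}$ (i.e. $\infty_{\mathcal{S}}+a=\infty_{\mathcal{S}}$ for all $a$) in which every element $x$ satisfies $nx=\infty_{\mathcal{S}}$ for some $n>0$. A sequence over $\mathcal{S}$ is a finite unordered sequence of elements of $\mathcal{S}$ with repetition allowed; $|A|$ is its length, $B\mid A$ means $B$ is a subsequence of $A$, and $\sigma(A)$ is the sum of its terms. The empty sequence is allowed as a subsequence only when $\mathcal{S}$ has an identity element $0_{\mathcal{S}}$, and then $\sigma(\text{empty})=0_{\mathcal{S}}$. A sequence $A$ is reducible if $\sigma(B)=\sigma(A)$ for some proper subsequence $B$ of $A$. $\mathsf D(\mathcal{S})$ is the smallest $\ell$ such that every sequence of length $\ge\ell$ is reducible. The period of $a$ is the least $t\ge1$ with $ra=(r+t)a$ for some $r>0$; $\exp(\mathcal{S})$ is the lcm of all periods; $\kappa(\mathcal{S})=\lceil |\mathcal{S}|/\exp(\mathcal{S})\rceil\exp(\mathcal{S})$. $\mathsf E(\mathcal{S})$ is the smallest positive integer $\ell$ such that every sequence $A$ of length $\ell$ contains a subsequence $B$ with $\sigma(B)=\sigma(A)$ and $|A|-|B|=\kappa(\mathcal{S})$. -}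

module Defs where

open import Data.Nat using (ℕ; zero; suc; _+_; _*_; _∸_; _≤_; _<_; NonZero)
open import Data.Nat.DivMod using (_/_)
open import Data.Nat.Divisibility using (_∣_)
open import Data.Fin using (Fin)
open import Data.List using (List; []; _∷_; length)
open import Data.List.Relation.Binary.Sublist.Propositional using (_⊆_)
open import Data.Product using (Σ; _×_; ∃)
open import Relation.Binary.PropositionalEquality using (_≡_)
open import Relation.Nullary using (¬_)
open import Algebra.Structures using (IsCommutativeSemigroup)

Least : (ℕ → Set) → ℕ → Set
Least P k = P k × (∀ m → m < k → ¬ P m)

-- mulS _⊕_ m x = (m + 1) x
mulS : {A : Set} → (A → A → A) → ℕ → A → A
mulS _⊕_ zero x = x
mulS _⊕_ (suc m) x = x ⊕ mulS _⊕_ m x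

-- A finite commutative nilsemigroup with |S| = n, carrier Fin n,
-- written additively, with zero element ∞.
record FinNilSemigroup (n : ℕ) : Set where
  field
    _⊕_ : Fin n → Fin n → Fin n
    isCommSemigroup : IsCommutativeSemigroup _≡_ _⊕_
    ∞ : Fin n
    ∞-absorb : ∀ a → ∞ ⊕ a ≡ ∞
    nil : ∀ x → ∃ λ m → mulS _⊕_ m x ≡ ∞

module _ {n : ℕ} (S : FinNilSemigroup n) where
  open FinNilSemigroup S

  mul : ℕ → Fin n → Fin n
  mul = mulS _⊕_

  Elem : Set
  Elem = Fin n

  IsIdentity : Elem → Set
  IsIdentity e = ∀ a → e ⊕ a ≡ a

  σ⁺ : Elem → List Elem → Elem
  σ⁺ x [] = x
  σ⁺ x (y ∷ ys) = x ⊕ σ⁺ y ys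

  -- SumIs A s : σ(A) is defined and equals s
  -- (the empty sequence has sum 0_S, only when S has an identity).
  SumIs : List Elem → Elem → Set
  SumIs [] s = IsIdentity s
  SumIs (x ∷ xs) s = σ⁺ x xs ≡ s

  -- B ⊆ A (sublist) models B ∣ A for unordered sequences.
  Reducible : List Elem → Set
  Reducible A = Σ (List Elem) λ B → B ⊆ A × length B < length A
                 × Σ Elem λ s → SumIs A s × SumIs B s

  DProp : ℕ → Set
  DProp ℓ = ∀ (A : List Elem) → ℓ ≤ length A → Reducible A

  IsD : ℕ → Set
  IsD = Least DProp

  PeriodProp : Elem → ℕ → Set
  PeriodProp a t = 1 ≤ t × ∃ λ r → mul r a ≡ mul (r + t) a

  IsPeriod : Elem → ℕ → Set
  IsPeriod a = Least (PeriodProp a)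

  IsExp : ℕ → Set
  IsExp e = (∀ a t → IsPeriod a t → t ∣ e)
          × (∀ m → (∀ a t → IsPeriod a t → t ∣ m) → e ∣ m)

  EProp : ℕ → ℕ → Set
  EProp κ ℓ = 1 ≤ ℓ × (∀ (A : List Elem) → length A ≡ ℓ →
                 Σ (List Elem) λ B → B ⊆ A × length A ≡ length B + κ
                 × Σ Elem λ s → SumIs A s × SumIs B s)

  IsE : ℕ → ℕ → Set
  IsE κ = Least (EProp κ)

-- κ(S) = ⌈ |S| / exp ⌉ * exp
kappa : (size e : ℕ) → .{{NonZero e}} → ℕ
kappa size e = ((size + e ∸ 1) / e) * e

-- In a nilsemigroup, s + c = s forces s = ∞: adding c repeatedly gives s = s + mc = s + ∞ = ∞.
-- Hence a reducible sequence always has sum ∞, and so does every sequence containing it.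
-- Given A of length D + κ - 1 with κ ≥ 1, pick a subsequence of length D; it is reducible,
-- witnessed by a proper subsequence B' of sum ∞. Enlarging B' to some B of length D - 1 gives
-- |A| - |B| = κ and σ(B) = ∞ = σ(A).
module Submission where

open import Defs
open import Data.Nat using (ℕ; zero; suc; _+_; _*_; _∸_; _≟_; _≤?_; _≤_; _<_; _>_; z≤n; s≤s;
  NonZero; >-nonZero; >-nonZero⁻¹)
open import Data.Nat.Properties
open import Data.Nat.DivMod using (_/_; m≥n⇒m/n>0)
open import Data.Product using (Σ; _×_; _,_; ∃)
open import Data.Sum using (_⊎_; inj₁; inj₂)
open import Data.Fin using (Fin)
open import Data.Fin.Properties using (all?; any?; nonZeroIndex) renaming (_≟_ to _≟ᶠ_)
open import Data.List using (List; []; _∷_; length)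
open import Data.List.Relation.Binary.Sublist.Propositional
  using (_⊆_; []; _∷_; _∷ʳ_; ⊆-refl; ⊆-trans; minimum)
open import Data.Empty using (⊥-elim)
open import Relation.Nullary using (¬_; Dec; yes; no)
open import Relation.Nullary.Decidable using (_×-dec_)
open import Relation.Unary using (Decidable)
open import Relation.Binary.PropositionalEquality using (_≡_; refl; sym; trans; cong; subst)
open import Algebra.Structures using (IsCommutativeSemigroup)

module _ {P : ℕ → Set} (P? : Decidable P) where

  least<⊎none< : ∀ k → (∃ λ j → j < k × Least P j) ⊎ (∀ m → m < k → ¬ P m)
  least<⊎none< zero = inj₂ λ _ ()
  least<⊎none< (suc k) with least<⊎none< k
  ... | inj₁ (j , j<k , least) = inj₁ (j , m<n⇒m<1+n j<k , least)
  ... | inj₂ none<k with P? k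
  ...   | yes Pk = inj₁ (k , ≤-refl , Pk , none<k)
  ...   | no ¬Pk = inj₂ none<1+k
    where
    none<1+k : ∀ m → m < suc k → ¬ P m
    none<1+k m m<1+k with m<1+n⇒m<n∨m≡n m<1+k
    ... | inj₁ m<k = none<k m m<k
    ... | inj₂ refl = ¬Pk

  least-≤ : ∀ {k} → P k → ∃ λ j → Least P j × j ≤ k
  least-≤ {k} Pk with least<⊎none< (suc k)
  ... | inj₁ (j , j<1+k , least) = j , least , ≤-pred j<1+k
  ... | inj₂ none = ⊥-elim (none k ≤-refl Pk)

module _ {X : Set} where

  any-⊆? : ∀ {Q : List X → Set} → Decidable Q → ∀ xs → Dec (∃ λ ys → ys ⊆ xs × Q ys)
  any-⊆? Q? [] with Q? []
  ... | yes q = yes ([] , [] , q)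
  ... | no ¬q = no λ { ([] , [] , q) → ¬q q }
  any-⊆? {Q} Q? (x ∷ xs) with any-⊆? Q? xs | any-⊆? {λ ys → Q (x ∷ ys)} (λ ys → Q? (x ∷ ys)) xs
  ... | yes (ys , p , q) | _ = yes (ys , x ∷ʳ p , q)
  ... | no _ | yes (ys , p , q) = yes (x ∷ ys , refl ∷ p , q)
  ... | no ¬skip | no ¬keep = no λ { (ys , x ∷ʳ p , q) → ¬skip (ys , p , q)
                                   ; (_ ∷ ys , refl ∷ p , q) → ¬keep (ys , p , q) }

  ⊆-interpolate : ∀ {ys xs} k → ys ⊆ xs → length ys ≤ k → k ≤ length xs →
                  ∃ λ (zs : List X) → ys ⊆ zs × zs ⊆ xs × length zs ≡ k
  ⊆-interpolate zero [] _ _ = [] , [] , [] , refl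
  ⊆-interpolate {xs = x ∷ xs} k (x ∷ʳ p) ys≤k k≤1+xs with k ≤? length xs
  ... | yes k≤xs = let zs , ys⊆zs , zs⊆xs , ∣zs∣ = ⊆-interpolate k p ys≤k k≤xs
                   in zs , ys⊆zs , x ∷ʳ zs⊆xs , ∣zs∣
  ... | no k≰xs = x ∷ xs , x ∷ʳ p , ⊆-refl , ≤-antisym (≰⇒> k≰xs) k≤1+xs
  ⊆-interpolate (suc k) (refl ∷ p) (s≤s ys≤k) (s≤s k≤xs) =
    let zs , ys⊆zs , zs⊆xs , ∣zs∣ = ⊆-interpolate k p ys≤k k≤xs
    in _ ∷ zs , refl ∷ ys⊆zs , refl ∷ zs⊆xs , cong suc ∣zs∣

all-length? : ∀ {n} {Q : List (Fin n) → Set} → Decidable Q →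
              ∀ m → Dec (∀ xs → length xs ≡ m → Q xs)
all-length? Q? zero with Q? []
... | yes q = yes λ { [] _ → q }
... | no ¬q = no λ all → ¬q (all [] refl)
all-length? {Q = Q} Q? (suc m)
  with all? (λ x → all-length? {Q = λ xs → Q (x ∷ xs)} (λ xs → Q? (x ∷ xs)) m)
... | yes all = yes λ { (x ∷ xs) ∣xs∣ → all x xs (suc-injective ∣xs∣) }
... | no ¬all = no λ all → ¬all λ x xs ∣xs∣ → all (x ∷ xs) (cong suc ∣xs∣)

kappa-positive : ∀ {size} e .{{_ : NonZero e}} → size > 0 → kappa size e > 0
kappa-positive {suc s} e _ =
  >-nonZero⁻¹ (q * e) {{m*n≢0 q e {{>-nonZero (m≥n⇒m/n>0 (m≤n+m e s))}}}}
  where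
  q : ℕ
  q = (s + e) / e

module _ {n : ℕ} (S : FinNilSemigroup n) where
  open FinNilSemigroup S
  open IsCommutativeSemigroup isCommSemigroup using (comm; assoc)

  absorbs-mul : ∀ {s c} m → s ⊕ c ≡ s → s ⊕ mul S m c ≡ s
  absorbs-mul zero s⊕c = s⊕c
  absorbs-mul {s} {c} (suc m) s⊕c = trans (sym (assoc s c (mul S m c)))
    (trans (cong (_⊕ mul S m c) s⊕c) (absorbs-mul m s⊕c))

  absorbs⇒≡∞ : ∀ {s c} → s ⊕ c ≡ s → s ≡ ∞
  absorbs⇒≡∞ {s} {c} s⊕c with nil c
  ... | m , mc≡∞ = trans (sym (absorbs-mul m s⊕c))
    (trans (cong (s ⊕_) mc≡∞) (trans (comm s ∞) (∞-absorb s)))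

  σ⁺-⊆ : ∀ {b B x A} → (b ∷ B) ⊆ (x ∷ A) → b ∷ B ≡ x ∷ A ⊎ ∃ λ c → σ⁺ S x A ≡ σ⁺ S b B ⊕ c
  σ⁺-⊆ {A = _ ∷ _} (x ∷ʳ p) with σ⁺-⊆ p
  ... | inj₁ refl = inj₂ (x , comm x _)
  ... | inj₂ (c , e) = inj₂ (x ⊕ c , trans (cong (x ⊕_) e)
         (trans (sym (assoc x _ c)) (trans (cong (_⊕ c) (comm x _)) (assoc _ x c))))
  σ⁺-⊆ {B = []} {A = []} (refl ∷ _) = inj₁ refl
  σ⁺-⊆ {B = []} {A = a ∷ A} (refl ∷ _) = inj₂ (σ⁺ S a A , refl)
  σ⁺-⊆ {b} {_ ∷ _} {A = _ ∷ _} (refl ∷ p) with σ⁺-⊆ p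
  ... | inj₁ refl = inj₁ refl
  ... | inj₂ (c , e) = inj₂ (c , trans (cong (b ⊕_) e) (sym (assoc b _ c)))

  sum-⊆ : ∀ {B A s t} → B ⊆ A → SumIs S B s → SumIs S A t → B ≡ A ⊎ ∃ λ c → t ≡ s ⊕ c
  sum-⊆ {A = []} [] _ _ = inj₁ refl
  sum-⊆ {[]} {_ ∷ _} {t = t} _ s-identity _ = inj₂ (t , sym (s-identity t))
  sum-⊆ {_ ∷ _} {_ ∷ _} p refl refl = σ⁺-⊆ p

  proper-⊆-sum⇒≡∞ : ∀ {B A s} → B ⊆ A → length B < length A →
                    SumIs S A s → SumIs S B s → s ≡ ∞
  proper-⊆-sum⇒≡∞ p ∣B∣<∣A∣ σA σB with sum-⊆ p σB σA
  ... | inj₁ refl = ⊥-elim (<-irrefl refl ∣B∣<∣A∣)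
  ... | inj₂ (c , s≡s⊕c) = absorbs⇒≡∞ (sym s≡s⊕c)

  sum-∞-⊆ : ∀ {B C} → B ⊆ C → SumIs S B ∞ → SumIs S C ∞
  sum-∞-⊆ [] σB = σB
  sum-∞-⊆ {C = _ ∷ _} p σB with sum-⊆ p σB refl
  ... | inj₁ refl = σB
  ... | inj₂ (c , e) = trans e (∞-absorb c)

  DProp-0-impossible : ¬ DProp S 0
  DProp-0-impossible D with D [] z≤n
  ... | _ , _ , () , _

  short-∞-⊆ : ∀ {d A} → DProp S (suc d) → suc d ≤ length A →
              ∃ λ B → B ⊆ A × length B ≤ d × SumIs S B ∞
  short-∞-⊆ {d} {A} D 1+d≤∣A∣ with ⊆-interpolate (suc d) (minimum A) z≤n 1+d≤∣A∣
  ... | A' , _ , A'⊆A , ∣A'∣ with D A' (≤-reflexive (sym ∣A'∣))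
  ... | B , B⊆A' , ∣B∣<∣A'∣ , _ , σA' , σB with proper-⊆-sum⇒≡∞ B⊆A' ∣B∣<∣A'∣ σA' σB
  ... | refl = B , ⊆-trans B⊆A' A'⊆A , ≤-pred (subst (length B <_) ∣A'∣ ∣B∣<∣A'∣) , σB

  DProp⇒EProp : ∀ {d} → DProp S d → ∀ {κ} → κ > 0 → EProp S κ (d + κ ∸ 1)
  DProp⇒EProp {zero} D _ = ⊥-elim (DProp-0-impossible D)
  DProp⇒EProp {suc d} D {suc κ} _ = ≤-trans (s≤s z≤n) (m≤n+m (suc κ) d) , witness
    where
    witness : ∀ A → length A ≡ d + suc κ → Σ (List (Elem S)) λ B → B ⊆ A
              × length A ≡ length B + suc κ × Σ (Elem S) λ s → SumIs S A s × SumIs S B s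
    witness A ∣A∣ =
      let 1+d≤∣A∣ = subst (suc d ≤_) (sym (trans ∣A∣ (+-suc d κ))) (s≤s (m≤m+n d κ))
          B' , B'⊆A , ∣B'∣≤d , σB' = short-∞-⊆ D 1+d≤∣A∣
          B , B'⊆B , B⊆A , ∣B∣ = ⊆-interpolate d B'⊆A ∣B'∣≤d (≤-trans (n≤1+n d) 1+d≤∣A∣)
      in B , B⊆A , trans ∣A∣ (cong (_+ suc κ) (sym ∣B∣))
         , ∞ , sum-∞-⊆ B'⊆A σB' , sum-∞-⊆ B'⊆B σB'

  SumIs? : ∀ A s → Dec (SumIs S A s)
  SumIs? [] s = all? (λ a → s ⊕ a ≟ᶠ a)
  SumIs? (x ∷ A) s = σ⁺ S x A ≟ᶠ s

  EProp? : ∀ κ → Decidable (EProp S κ)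
  EProp? κ ℓ = (1 ≤? ℓ) ×-dec all-length? (λ A → any-⊆? (λ B → (length A ≟ length B + κ) ×-dec
                  any? (λ s → SumIs? A s ×-dec SumIs? B s)) A) ℓ

mainTheorem2 : ∀ {n : ℕ} (S : FinNilSemigroup n) (ex : ℕ) → IsExp S ex → .{{_ : NonZero ex}}
    → ∀ (d : ℕ) → IsD S d
    → Σ ℕ λ E → IsE S (kappa n ex) E × E ≤ d + kappa n ex ∸ 1
mainTheorem2 {n} S ex _ d (D , _) = least-≤ (EProp? S (kappa n ex)) (DProp⇒EProp S D κ>0)
  where
  κ>0 : kappa n ex > 0
  κ>0 = kappa-positive ex (>-nonZero⁻¹ n {{nonZeroIndex (FinNilSemigroup.∞ S)}})
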